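{- For every integer $n\ge 3$ and every positive integer $k$, \[ \nu_k(K_{n}) = |E_n| - \mbox{max- }k\mbox{ -cut}(G_n), \] where $\mbox{max- }k\mbox{ -cut}(G_n)$ denotes the maximum number of edges of $G_n$ whose endpoints receive different colours, over all colourings of the vertices of $G_n$ with $k$ colours.
   Context: A $k$-page drawing of a graph places its vertices on a line (the spine) and draws each edge in one of $k$ half-planes (pages) bounded by the spine; equivalently, it is a set of $k$ circular drawings (vertices on a circle in a common cyclic order, edges as chords inside the circle) of graphs $(V,E^{(i)})$, $i=1,\dots,k$, where $E^{(1)},\dots,E^{(k)}$ partition the edge set. The $k$-page crossing number $\nu_k(G)$ is the minimum number of crossings in a $k$-page drawing of $G$. The graph $G_n=(V_n,E_n)$ is defined as follows: take a Hamiltonian cycle $C_n$ on vertices $v_1,\dots,v_n$; $V_n$ is the set of chords of $C_n$, i.e. pairs $v_iv_j$ with $v_i,v_j$ at cyclic distance at least $2$; two chords $v_iv_j$ and $v_kv_\ell$ are adjacent in $G_n$ if they overlap, i.e. $i,k,j,\ell$ occur in this cyclic order when traversing $C_n$ (in either direction). -}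

module Defs where

open import Data.Nat using (ℕ; _<_; _≤_; _+_; _∸_; _⊓_; _⊔_)
open import Data.Nat.Properties using (_<?_; _≤?_)
open import Data.Fin using (Fin; toℕ)
import Data.Fin.Properties as FinP
open import Data.Fin.Permutation using (Permutation′; _⟨$⟩ʳ_)
open import Data.List using (List; []; _∷_; map; _++_; filter; length; allFin; cartesianProduct)
open import Data.Product using (_×_; _,_; proj₁; proj₂)
open import Data.Sum using (_⊎_)
open import Relation.Nullary using (Dec)
open import Relation.Nullary.Decidable using (_×-dec_; _⊎-dec_)
open import Relation.Binary.PropositionalEquality using (_≡_)

pairs : {A : Set} → List A → List (A × A)
pairs []       = []
pairs (x ∷ xs) = map (x ,_) xs ++ pairs xs

-- Two segments {x,y} and {u,v} of a line (equivalently chords of a circle)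
-- interleave: their endpoints alternate strictly.
Interleave : ℕ → ℕ → ℕ → ℕ → Set
Interleave x y u v =
  let a = x ⊓ y ; b = x ⊔ y ; c = u ⊓ v ; d = u ⊔ v in
  (a < c × c < b × b < d) ⊎ (c < a × a < d × d < b)

interleave? : ∀ x y u v → Dec (Interleave x y u v)
interleave? x y u v =
  let a = x ⊓ y ; b = x ⊔ y ; c = u ⊓ v ; d = u ⊔ v in
  (a <? c ×-dec (c <? b ×-dec b <? d)) ⊎-dec (c <? a ×-dec (a <? d ×-dec d <? b))

-- Edges of K_n on vertex set Fin n: pairs (i , j) with i < j.
KEdge : ℕ → Set
KEdge n = Fin n × Fin n

edgesK : (n : ℕ) → List (KEdge n)
edgesK n = filter (λ e → proj₁ e FinP.<? proj₂ e) (cartesianProduct (allFin n) (allFin n))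

-- A k-page drawing: the order of the vertices along the spine
-- (pos i = position of vertex i) and an assignment of edges to pages.
record Drawing (k n : ℕ) : Set where
  field
    pos  : Permutation′ n
    page : KEdge n → Fin k

crossings : ∀ {k n} → Drawing k n → ℕ
crossings {k} {n} D = length (filter cross? (pairs (edgesK n)))
  where
    open Drawing D
    p : Fin n → ℕ
    p i = toℕ (pos ⟨$⟩ʳ i)
    cross? : (ef : KEdge n × KEdge n) → Dec _
    cross? (e , f) =
      (page e FinP.≟ page f)
        ×-dec interleave? (p (proj₁ e)) (p (proj₂ e)) (p (proj₁ f)) (p (proj₂ f))

-- Chord v_i v_j (i < j) of the Hamiltonian cycle v_0 … v_{n-1}:
-- cyclic distance at least 2, i.e. 2 ≤ j - i and (j - i) + 2 ≤ n.
IsChord : (n : ℕ) → Fin n × Fin n → Set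
IsChord n (i , j) = toℕ i < toℕ j × 2 ≤ toℕ j ∸ toℕ i × (toℕ j ∸ toℕ i) + 2 ≤ n

isChord? : (n : ℕ) → (c : Fin n × Fin n) → Dec (IsChord n c)
isChord? n (i , j) = (toℕ i <? toℕ j) ×-dec ((2 ≤? toℕ j ∸ toℕ i) ×-dec ((toℕ j ∸ toℕ i) + 2 ≤? n))

Vn : (n : ℕ) → List (Fin n × Fin n)
Vn n = filter (isChord? n) (cartesianProduct (allFin n) (allFin n))

overlap? : ∀ {n} (cd : (Fin n × Fin n) × (Fin n × Fin n)) → Dec _
overlap? ((i , j) , (k , l)) = interleave? (toℕ i) (toℕ j) (toℕ k) (toℕ l)

En : (n : ℕ) → List ((Fin n × Fin n) × (Fin n × Fin n))
En n = filter overlap? (pairs (Vn n))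

cutSize : ∀ {k n} → (Fin n × Fin n → Fin k) → ℕ
cutSize {k} {n} col = length (filter (λ e → ¬? (col (proj₁ e) FinP.≟ col (proj₂ e))) (En n))
  where open import Relation.Nullary using (¬?)

-- Put the vertices of K_n on the spine in the order 0, 1, …, n-1. Two edges can then cross only
-- if both are chords of the Hamiltonian cycle 0, 1, …, n-1, and they cross exactly when they
-- overlap; so a page assignment is a k-colouring of G_n whose crossings are its monochromatic
-- edges, i.e. |E_n| minus its cut. Every drawing becomes such a drawing, with the same number of
-- crossings, after renaming each vertex by its spine position: counted over ordered quadruples
-- (i, j, u, v) of vertices, crossings are visibly invariant under a permutation of the vertices.
-- Hence a maximum k-cut gives an optimal drawing.
module Submission where

open import Defs
open import Data.Nat using (ℕ; zero; suc; _+_; _*_; _≤_; _<_; _∸_; _⊓_; _⊔_; z≤n; s≤s)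
open import Data.Nat.Properties
open import Data.Fin using (Fin; toℕ) renaming (zero to fzero; suc to fsuc)
import Data.Fin.Properties as FinP
open import Data.Fin.Permutation using (Permutation′; _⟨$⟩ʳ_; _⟨$⟩ˡ_; inverseˡ) renaming (id to idPerm)
open import Data.List using (List; tabulate; []; _∷_; map; _++_; filter; length; allFin; cartesianProduct; concatMap)
open import Data.List.Extrema.Nat using (argmax; f[xs]≤f[argmax])
open import Data.List.Membership.Propositional using (_∈_)
open import Data.List.Membership.Propositional.Properties using (∈-map⁺; ∈-concatMap⁺; ∈-allFin; ∈-cartesianProduct⁺)
open import Data.List.Relation.Unary.Any using (here; there)
import Data.List.Relation.Unary.Any as Any
import Data.List.Relation.Unary.All as All
open import Data.Product using (Σ; _×_; _,_; proj₁; proj₂)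
open import Data.Product.Properties using (≡-dec)
open import Data.Sum using (_⊎_; inj₁; inj₂)
open import Data.Empty using (⊥-elim)
open import Function using (_∘_)
open import Relation.Nullary using (Dec; yes; no; ¬_; ¬?)
open import Relation.Nullary.Decidable using (_×-dec_)
open import Relation.Binary.Definitions using (DecidableEquality)
open import Relation.Binary.PropositionalEquality
open import Algebra.Properties.CommutativeSemigroup +-commutativeSemigroup
  using () renaming (x∙yz≈y∙xz to x+[y+z]≡y+[x+z])
open import Algebra.Properties.CommutativeSemigroup *-commutativeSemigroup
  using () renaming (x∙yz≈y∙xz to x*[y*z]≡y*[x*z])
open import Algebra.Properties.Semiring.Sum +-*-semiring
  using (sum; sum-cong-≗; ∑-distrib-+; ∑-comm; ∑-permute; sum-replicate-zero; *-distribˡ-sum)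

𝟙 : {P : Set} → Dec P → ℕ
𝟙 (yes _) = 1
𝟙 (no _)  = 0

𝟙-cong : {P Q : Set} → (P → Q) → (Q → P) → (p : Dec P) (q : Dec Q) → 𝟙 p ≡ 𝟙 q
𝟙-cong P⇒Q Q⇒P (yes p) (yes q) = refl
𝟙-cong P⇒Q Q⇒P (yes p) (no ¬q) = ⊥-elim (¬q (P⇒Q p))
𝟙-cong P⇒Q Q⇒P (no ¬p) (yes q) = ⊥-elim (¬p (Q⇒P q))
𝟙-cong P⇒Q Q⇒P (no ¬p) (no ¬q) = refl

𝟙-no : {P : Set} → ¬ P → (p : Dec P) → 𝟙 p ≡ 0
𝟙-no ¬p (yes p) = ⊥-elim (¬p p)
𝟙-no ¬p (no _)  = refl

𝟙-× : {P Q : Set} (p : Dec P) (q : Dec Q) → 𝟙 (p ×-dec q) ≡ 𝟙 p * 𝟙 q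
𝟙-× (yes _) (yes _) = refl
𝟙-× (yes _) (no _)  = refl
𝟙-× (no _)  _       = refl

𝟙-*-cong : {P : Set} {a b : ℕ} → (P → a ≡ b) → (p : Dec P) → 𝟙 p * a ≡ 𝟙 p * b
𝟙-*-cong a≡b (yes p) = cong (_+ 0) (a≡b p)
𝟙-*-cong a≡b (no _)  = refl

𝟙³-cong : {A B C A′ B′ C′ : Set} →
  (A × B × C → A′ × B′ × C′) → (A′ × B′ × C′ → A × B × C) →
  (a : Dec A) (b : Dec B) (c : Dec C) (a′ : Dec A′) (b′ : Dec B′) (c′ : Dec C′) →
  𝟙 a * (𝟙 b * 𝟙 c) ≡ 𝟙 a′ * (𝟙 b′ * 𝟙 c′)
𝟙³-cong ⇒ ⇐ a b c a′ b′ c′ = begin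
  𝟙 a * (𝟙 b * 𝟙 c)              ≡⟨ cong (𝟙 a *_) (𝟙-× b c) ⟨
  𝟙 a * 𝟙 (b ×-dec c)            ≡⟨ 𝟙-× a (b ×-dec c) ⟨
  𝟙 (a ×-dec (b ×-dec c))        ≡⟨ 𝟙-cong ⇒ ⇐ _ _ ⟩
  𝟙 (a′ ×-dec (b′ ×-dec c′))     ≡⟨ 𝟙-× a′ (b′ ×-dec c′) ⟩
  𝟙 a′ * 𝟙 (b′ ×-dec c′)         ≡⟨ cong (𝟙 a′ *_) (𝟙-× b′ c′) ⟩
  𝟙 a′ * (𝟙 b′ * 𝟙 c′)           ∎
  where open ≡-Reasoning

module _ {A : Set} where

  ∑ₗ : List A → (A → ℕ) → ℕ
  ∑ₗ []       f = 0
  ∑ₗ (x ∷ xs) f = f x + ∑ₗ xs f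

  ∑ₗ-cong : ∀ xs {f g : A → ℕ} → (∀ x → f x ≡ g x) → ∑ₗ xs f ≡ ∑ₗ xs g
  ∑ₗ-cong []       f≗g = refl
  ∑ₗ-cong (x ∷ xs) f≗g = cong₂ _+_ (f≗g x) (∑ₗ-cong xs f≗g)

  ∑ₗ-++ : ∀ xs ys (f : A → ℕ) → ∑ₗ (xs ++ ys) f ≡ ∑ₗ xs f + ∑ₗ ys f
  ∑ₗ-++ []       ys f = refl
  ∑ₗ-++ (x ∷ xs) ys f = trans (cong (f x +_) (∑ₗ-++ xs ys f)) (sym (+-assoc (f x) _ _))

  ∑ₗ-+ : ∀ xs (f g : A → ℕ) → ∑ₗ xs (λ x → f x + g x) ≡ ∑ₗ xs f + ∑ₗ xs g
  ∑ₗ-+ []       f g = refl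
  ∑ₗ-+ (x ∷ xs) f g = begin
    f x + g x + ∑ₗ xs (λ x → f x + g x)  ≡⟨ cong (f x + g x +_) (∑ₗ-+ xs f g) ⟩
    f x + g x + (∑ₗ xs f + ∑ₗ xs g)      ≡⟨ +-assoc (f x) (g x) _ ⟩
    f x + (g x + (∑ₗ xs f + ∑ₗ xs g))    ≡⟨ cong (f x +_) (x+[y+z]≡y+[x+z] (g x) (∑ₗ xs f) _) ⟩
    f x + (∑ₗ xs f + (g x + ∑ₗ xs g))    ≡⟨ +-assoc (f x) _ _ ⟨
    f x + ∑ₗ xs f + (g x + ∑ₗ xs g)      ∎
    where open ≡-Reasoning

  ∑ₗ-filter : ∀ {P : A → Set} (P? : ∀ x → Dec (P x)) xs (f : A → ℕ) →
    ∑ₗ (filter P? xs) f ≡ ∑ₗ xs (λ x → 𝟙 (P? x) * f x)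
  ∑ₗ-filter P? []       f = refl
  ∑ₗ-filter P? (x ∷ xs) f with P? x
  ... | yes _ = cong₂ _+_ (sym (+-identityʳ (f x))) (∑ₗ-filter P? xs f)
  ... | no _  = ∑ₗ-filter P? xs f

  length-filter : ∀ {P : A → Set} (P? : ∀ x → Dec (P x)) xs →
    length (filter P? xs) ≡ ∑ₗ xs (𝟙 ∘ P?)
  length-filter P? []       = refl
  length-filter P? (x ∷ xs) with P? x
  ... | yes _ = cong suc (length-filter P? xs)
  ... | no _  = length-filter P? xs

  length-filter-filter : ∀ {P Q : A → Set} (P? : ∀ x → Dec (P x)) (Q? : ∀ x → Dec (Q x)) xs →
    length (filter Q? (filter P? xs)) ≡ ∑ₗ xs (λ x → 𝟙 (P? x ×-dec Q? x))
  length-filter-filter P? Q? xs = begin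
    length (filter Q? (filter P? xs))          ≡⟨ length-filter Q? (filter P? xs) ⟩
    ∑ₗ (filter P? xs) (𝟙 ∘ Q?)                 ≡⟨ ∑ₗ-filter P? xs (𝟙 ∘ Q?) ⟩
    ∑ₗ xs (λ x → 𝟙 (P? x) * 𝟙 (Q? x))          ≡⟨ ∑ₗ-cong xs (λ x → 𝟙-× (P? x) (Q? x)) ⟨
    ∑ₗ xs (λ x → 𝟙 (P? x ×-dec Q? x))          ∎
    where open ≡-Reasoning

  length-filter+length-filter-¬ : ∀ {P : A → Set} (P? : ∀ x → Dec (P x)) xs →
    length (filter P? xs) + length (filter (¬? ∘ P?) xs) ≡ length xs
  length-filter+length-filter-¬ P? []       = refl
  length-filter+length-filter-¬ P? (x ∷ xs) with P? x
  ... | yes _ = cong suc (length-filter+length-filter-¬ P? xs)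
  ... | no _  = trans (+-suc _ _) (cong suc (length-filter+length-filter-¬ P? xs))

∑ₗ-map : ∀ {A B : Set} (h : A → B) xs (f : B → ℕ) → ∑ₗ (map h xs) f ≡ ∑ₗ xs (f ∘ h)
∑ₗ-map h []       f = refl
∑ₗ-map h (x ∷ xs) f = cong (f (h x) +_) (∑ₗ-map h xs f)

∑ₗ-cartesianProduct : ∀ {A B : Set} xs (ys : List B) (f : A × B → ℕ) →
  ∑ₗ (cartesianProduct xs ys) f ≡ ∑ₗ xs (λ x → ∑ₗ ys (λ y → f (x , y)))
∑ₗ-cartesianProduct []       ys f = refl
∑ₗ-cartesianProduct (x ∷ xs) ys f =
  trans (∑ₗ-++ (map (x ,_) ys) _ f) (cong₂ _+_ (∑ₗ-map (x ,_) ys f) (∑ₗ-cartesianProduct xs ys f))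

∑ₗ-pairs : ∀ {A : Set} xs (f : A × A → ℕ) →
  (∀ x y → f (x , y) ≡ f (y , x)) → (∀ x → f (x , x) ≡ 0) →
  2 * ∑ₗ (pairs xs) f ≡ ∑ₗ xs (λ x → ∑ₗ xs (λ y → f (x , y)))
∑ₗ-pairs []       f f-sym f-diag = refl
∑ₗ-pairs (z ∷ xs) f f-sym f-diag = begin
  2 * ∑ₗ (map (z ,_) xs ++ pairs xs) f
    ≡⟨ cong (2 *_) (∑ₗ-++ (map (z ,_) xs) _ f) ⟩
  2 * (∑ₗ (map (z ,_) xs) f + ∑ₗ (pairs xs) f)
    ≡⟨ cong (λ s → 2 * (s + _)) (∑ₗ-map (z ,_) xs f) ⟩
  2 * (R + ∑ₗ (pairs xs) f)
    ≡⟨ *-distribˡ-+ 2 R _ ⟩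
  2 * R + 2 * ∑ₗ (pairs xs) f
    ≡⟨ cong (2 * R +_) (∑ₗ-pairs xs f f-sym f-diag) ⟩
  (R + (R + 0)) + T
    ≡⟨ cong (λ s → R + s + T) (+-identityʳ R) ⟩
  (R + R) + T
    ≡⟨ +-assoc R R T ⟩
  R + (R + T)
    ≡⟨ cong₂ _+_ (cong (_+ R) (f-diag z)) (cong (_+ T) (∑ₗ-cong xs (λ y → f-sym y z))) ⟨
  (f (z , z) + R) + (C + T)
    ≡⟨ cong (f (z , z) + R +_) (∑ₗ-+ xs (λ y → f (y , z)) _) ⟨
  (f (z , z) + R) + ∑ₗ xs (λ x → f (x , z) + ∑ₗ xs (λ y → f (x , y))) ∎
  where
    open ≡-Reasoning
    R = ∑ₗ xs (λ y → f (z , y))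
    C = ∑ₗ xs (λ y → f (y , z))
    T = ∑ₗ xs (λ x → ∑ₗ xs (λ y → f (x , y)))

∑ₗ-tabulate : ∀ {A : Set} n (g : Fin n → A) (f : A → ℕ) → ∑ₗ (tabulate g) f ≡ sum λ i → f (g i)
∑ₗ-tabulate zero    g f = refl
∑ₗ-tabulate (suc n) g f = cong (f (g fzero) +_) (∑ₗ-tabulate n (g ∘ fsuc) f)

∑ₗ-filter-allFin² : ∀ n {P : Fin n × Fin n → Set} (P? : ∀ e → Dec (P e)) (f : Fin n × Fin n → ℕ) →
  ∑ₗ (filter P? (cartesianProduct (allFin n) (allFin n))) f ≡ sum λ i → sum λ j → 𝟙 (P? (i , j)) * f (i , j)
∑ₗ-filter-allFin² n P? f = begin
  ∑ₗ (filter P? (cartesianProduct (allFin n) (allFin n))) f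
    ≡⟨ ∑ₗ-filter P? (cartesianProduct (allFin n) (allFin n)) f ⟩
  ∑ₗ (cartesianProduct (allFin n) (allFin n)) g
    ≡⟨ ∑ₗ-cartesianProduct (allFin n) (allFin n) g ⟩
  ∑ₗ (allFin n) (λ i → ∑ₗ (allFin n) (λ j → g (i , j)))
    ≡⟨ ∑ₗ-cong (allFin n) (λ i → ∑ₗ-tabulate n _ _) ⟩
  ∑ₗ (allFin n) (λ i → sum λ j → g (i , j))
    ≡⟨ ∑ₗ-tabulate n _ _ ⟩
  (sum λ i → sum λ j → g (i , j)) ∎
  where
    open ≡-Reasoning
    g : Fin n × Fin n → ℕ
    g e = 𝟙 (P? e) * f e

∑-zero : ∀ {n} {f : Fin n → ℕ} → (∀ i → f i ≡ 0) → sum f ≡ 0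
∑-zero {n} f≗0 = trans (sum-cong-≗ f≗0) (sum-replicate-zero n)

*-distribˡ-∑² : ∀ {n} x (f : Fin n → Fin n → ℕ) →
  x * (sum λ i → sum λ j → f i j) ≡ (sum λ i → sum λ j → x * f i j)
*-distribˡ-∑² x f = trans (*-distribˡ-sum x (λ i → sum (f i))) (sum-cong-≗ λ i → *-distribˡ-sum x (f i))

∑⁴ : ∀ {n} → (Fin n → Fin n → Fin n → Fin n → ℕ) → ℕ
∑⁴ G = sum λ i → sum λ j → sum λ u → sum λ v → G i j u v

∑⁴-cong : ∀ {n} {F G : Fin n → Fin n → Fin n → Fin n → ℕ} →
  (∀ i j u v → F i j u v ≡ G i j u v) → ∑⁴ F ≡ ∑⁴ G
∑⁴-cong F≗G = sum-cong-≗ λ i → sum-cong-≗ λ j → sum-cong-≗ λ u → sum-cong-≗ λ v → F≗G i j u v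

∑²-*-∑² : ∀ {n} (a : Fin n → Fin n → ℕ) (b : Fin n → Fin n → Fin n → Fin n → ℕ) →
  (sum λ i → sum λ j → a i j * sum λ u → sum λ v → b i j u v) ≡ ∑⁴ (λ i j u v → a i j * b i j u v)
∑²-*-∑² a b = sum-cong-≗ λ i → sum-cong-≗ λ j → *-distribˡ-∑² (a i j) (b i j)

∑²-symmetric : ∀ {n} (g : Fin n → Fin n → ℕ) → (∀ i j → g i j ≡ g j i) → (∀ i → g i i ≡ 0) →
  (sum λ i → sum λ j → g i j) ≡ 2 * (sum λ i → sum λ j → 𝟙 (i FinP.<? j) * g i j)
∑²-symmetric {n} g g-sym g-diag = begin
  (sum λ i → sum λ j → g i j)
    ≡⟨ sum-cong-≗ (λ i → trans (sum-cong-≗ (split i)) (∑-distrib-+ (above i) (below i))) ⟩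
  (sum λ i → sum (above i) + sum (below i))
    ≡⟨ ∑-distrib-+ (sum ∘ above) (sum ∘ below) ⟩
  U + (sum λ i → sum λ j → 𝟙 (j FinP.<? i) * g i j)
    ≡⟨ cong (U +_) (∑-comm (λ i j → 𝟙 (j FinP.<? i) * g i j)) ⟩
  U + (sum λ j → sum λ i → 𝟙 (j FinP.<? i) * g i j)
    ≡⟨ cong (U +_) (sum-cong-≗ λ j → sum-cong-≗ λ i → cong (𝟙 (j FinP.<? i) *_) (g-sym i j)) ⟩
  U + U
    ≡⟨ cong (U +_) (+-identityʳ U) ⟨
  2 * U ∎
  where
    open ≡-Reasoning
    above below : Fin n → Fin n → ℕ
    above i j = 𝟙 (i FinP.<? j) * g i j
    below i j = 𝟙 (j FinP.<? i) * g i j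
    U = sum λ i → sum (above i)
    split : ∀ i j → g i j ≡ above i j + below i j
    split i j with i FinP.<? j | j FinP.<? i
    ... | yes i<j | yes j<i = ⊥-elim (<-asym i<j j<i)
    ... | yes _   | no _    = sym (trans (+-identityʳ _) (+-identityʳ _))
    ... | no _    | yes _   = sym (+-identityʳ _)
    ... | no i≮j  | no j≮i with FinP.toℕ-injective (≤-antisym (≮⇒≥ j≮i) (≮⇒≥ i≮j))
    ...   | refl = g-diag i

∑⁴-permute : ∀ {n} (σ : Permutation′ n) G →
  ∑⁴ G ≡ ∑⁴ (λ i j u v → G (σ ⟨$⟩ʳ i) (σ ⟨$⟩ʳ j) (σ ⟨$⟩ʳ u) (σ ⟨$⟩ʳ v))
∑⁴-permute σ G =
  trans (∑-permute (λ i → sum λ j → sum λ u → sum λ v → G i j u v) σ) (sum-cong-≗ λ i →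
  trans (∑-permute (λ j → sum λ u → sum λ v → G (σ ⟨$⟩ʳ i) j u v) σ) (sum-cong-≗ λ j →
  trans (∑-permute (λ u → sum λ v → G (σ ⟨$⟩ʳ i) (σ ⟨$⟩ʳ j) u v) σ) (sum-cong-≗ λ u →
  ∑-permute (G (σ ⟨$⟩ʳ i) (σ ⟨$⟩ʳ j) (σ ⟨$⟩ʳ u)) σ)))

private
  Alternating : ℕ → ℕ → ℕ → ℕ → Set
  Alternating a b c d = (a < c × c < b × b < d) ⊎ (c < a × a < d × d < b)

Interleave-swap : ∀ x y u v → Interleave x y u v → Interleave u v x y
Interleave-swap x y u v (inj₁ p) = inj₂ p
Interleave-swap x y u v (inj₂ p) = inj₁ p

Interleave-flipˡ : ∀ x y u v → Interleave x y u v → Interleave y x u v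
Interleave-flipˡ x y u v = subst₂ (λ a b → Alternating a b (u ⊓ v) (u ⊔ v)) (⊓-comm x y) (⊔-comm x y)

Interleave-flipʳ : ∀ x y u v → Interleave x y u v → Interleave x y v u
Interleave-flipʳ x y u v = Interleave-swap v u x y ∘ Interleave-flipˡ u v x y ∘ Interleave-swap x y u v

Interleave-irreflˡ : ∀ x u v → ¬ Interleave x x u v
Interleave-irreflˡ x u v p with subst₂ (λ a b → Alternating a b (u ⊓ v) (u ⊔ v)) (⊓-idem x) (⊔-idem x) p
... | inj₁ (x<c , c<x , _) = <-asym x<c c<x
... | inj₂ (_ , x<d , d<x) = <-asym x<d d<x

Interleave-irrefl : ∀ x y → ¬ Interleave x y x y
Interleave-irrefl x y (inj₁ (a<a , _)) = <-irrefl refl a<a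
Interleave-irrefl x y (inj₂ (a<a , _)) = <-irrefl refl a<a

Interleave-sorted : ∀ {x y u v} → x < y → u < v → Interleave x y u v → Alternating x y u v
Interleave-sorted {x} {y} {u} {v} x<y u<v =
  subst₂ (λ c d → Alternating x y c d) (m≤n⇒m⊓n≡m (<⇒≤ u<v)) (m≤n⇒m⊔n≡n (<⇒≤ u<v)) ∘
  subst₂ (λ a b → Alternating a b (u ⊓ v) (u ⊔ v)) (m≤n⇒m⊓n≡m (<⇒≤ x<y)) (m≤n⇒m⊔n≡n (<⇒≤ x<y))

a<c<b⇒2≤b∸a : ∀ a c b → a < c → c < b → 2 ≤ b ∸ a
a<c<b⇒2≤b∸a zero    c       (suc b) a<c       (s≤s c≤b) = s≤s (≤-trans a<c c≤b)
a<c<b⇒2≤b∸a (suc a) (suc c) (suc b) (s≤s a<c) (s≤s c<b) = a<c<b⇒2≤b∸a a c b a<c c<b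

b<d<n⇒b∸a+2≤n : ∀ a b d n → b < d → d < n → b ∸ a + 2 ≤ n
b<d<n⇒b∸a+2≤n a b d n b<d d<n =
  ≤-trans (+-monoˡ-≤ 2 (m∸n≤m b a)) (subst (_≤ n) (+-comm 2 b) (≤-trans (s≤s b<d) d<n))

0<a<b<n⇒b∸a+2≤n : ∀ a b n → 0 < a → a < b → b < n → b ∸ a + 2 ≤ n
0<a<b<n⇒b∸a+2≤n (suc a) (suc b) (suc n) _ _ (s≤s b<n) =
  ≤-trans (+-monoˡ-≤ 2 (m∸n≤m b a)) (subst (_≤ suc n) (+-comm 2 b) (s≤s b<n))

interleave⇒chord : ∀ {n} (i j u v : Fin n) → toℕ i < toℕ j → toℕ u < toℕ v →
  Interleave (toℕ i) (toℕ j) (toℕ u) (toℕ v) → IsChord n (i , j)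
interleave⇒chord {n} i j u v i<j u<v p with Interleave-sorted i<j u<v p
... | inj₁ (i<u , u<j , j<v) =
  i<j , a<c<b⇒2≤b∸a _ _ _ i<u u<j , b<d<n⇒b∸a+2≤n (toℕ i) _ _ n j<v (FinP.toℕ<n v)
... | inj₂ (u<i , i<v , v<j) =
  i<j , a<c<b⇒2≤b∸a _ _ _ i<v v<j , 0<a<b<n⇒b∸a+2≤n _ _ n (≤-trans (s≤s z≤n) u<i) i<j (FinP.toℕ<n j)

edge : ∀ {n} → Fin n → Fin n → KEdge n
edge i j with i FinP.<? j
... | yes _ = i , j
... | no _  = j , i

edge-sorted : ∀ {n} {i j : Fin n} → toℕ i < toℕ j → edge i j ≡ (i , j)
edge-sorted {i = i} {j} i<j with i FinP.<? j
... | yes _   = refl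
... | no i≮j = ⊥-elim (i≮j i<j)

edge-comm : ∀ {n} (i j : Fin n) → edge i j ≡ edge j i
edge-comm i j with i FinP.<? j | j FinP.<? i
... | yes i<j | yes j<i = ⊥-elim (<-asym i<j j<i)
... | yes _   | no _    = refl
... | no _    | yes _   = refl
... | no i≮j  | no j≮i with FinP.toℕ-injective (≤-antisym (≮⇒≥ j≮i) (≮⇒≥ i≮j))
...   | refl = refl

edge-map : ∀ {n m} (τ : Fin n → Fin m) (i j : Fin n) →
  edge (τ (proj₁ (edge i j))) (τ (proj₂ (edge i j))) ≡ edge (τ i) (τ j)
edge-map τ i j with i FinP.<? j
... | yes _ = refl
... | no _  = edge-comm (τ j) (τ i)

module _ {k n : ℕ} (D : Drawing k n) where
  open Drawing D

  spinePosition : Fin n → ℕ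
  spinePosition i = toℕ (pos ⟨$⟩ʳ i)

  Crosses : KEdge n × KEdge n → Set
  Crosses (e , f) = page e ≡ page f ×
    Interleave (spinePosition (proj₁ e)) (spinePosition (proj₂ e)) (spinePosition (proj₁ f)) (spinePosition (proj₂ f))

  crosses? : ∀ ef → Dec (Crosses ef)
  crosses? (e , f) = (page e FinP.≟ page f) ×-dec
    interleave? (spinePosition (proj₁ e)) (spinePosition (proj₂ e)) (spinePosition (proj₁ f)) (spinePosition (proj₂ f))

  2*crossings≡∑sorted : 2 * crossings D ≡
    (sum λ i → sum λ j → 𝟙 (i FinP.<? j) *
      sum λ u → sum λ v → 𝟙 (u FinP.<? v) * 𝟙 (crosses? ((i , j) , (u , v))))
  2*crossings≡∑sorted = begin
    2 * length (filter crosses? (pairs (edgesK n)))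
      ≡⟨ cong (2 *_) (length-filter crosses? (pairs (edgesK n))) ⟩
    2 * ∑ₗ (pairs (edgesK n)) (𝟙 ∘ crosses?)
      ≡⟨ ∑ₗ-pairs (edgesK n) (𝟙 ∘ crosses?) symmetric irreflexive ⟩
    ∑ₗ (edgesK n) (λ e → ∑ₗ (edgesK n) (λ f → 𝟙 (crosses? (e , f))))
      ≡⟨ ∑ₗ-cong (edgesK n) (λ e → ∑ₗ-filter-allFin² n _ _) ⟩
    ∑ₗ (edgesK n) (λ e → sum λ u → sum λ v → 𝟙 (u FinP.<? v) * 𝟙 (crosses? (e , (u , v))))
      ≡⟨ ∑ₗ-filter-allFin² n _ _ ⟩
    (sum λ i → sum λ j → 𝟙 (i FinP.<? j) *
      sum λ u → sum λ v → 𝟙 (u FinP.<? v) * 𝟙 (crosses? ((i , j) , (u , v)))) ∎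
    where
      open ≡-Reasoning
      swap : ∀ e f → Crosses (e , f) → Crosses (f , e)
      swap _ _ (same , il) = sym same , Interleave-swap _ _ _ _ il
      symmetric : ∀ e f → 𝟙 (crosses? (e , f)) ≡ 𝟙 (crosses? (f , e))
      symmetric e f = 𝟙-cong (swap e f) (swap f e) _ _
      irreflexive : ∀ e → 𝟙 (crosses? (e , e)) ≡ 0
      irreflexive e = 𝟙-no (λ (_ , il) → Interleave-irrefl _ _ il) _

  CrossingQuadruple : Fin n → Fin n → Fin n → Fin n → Set
  CrossingQuadruple i j u v = page (edge i j) ≡ page (edge u v) ×
    Interleave (spinePosition i) (spinePosition j) (spinePosition u) (spinePosition v)

  crossingQuadruple? : ∀ i j u v → Dec (CrossingQuadruple i j u v)
  crossingQuadruple? i j u v = (page (edge i j) FinP.≟ page (edge u v)) ×-dec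
    interleave? (spinePosition i) (spinePosition j) (spinePosition u) (spinePosition v)

  CrossingQuadruple-flipˡ : ∀ {i j u v} → CrossingQuadruple i j u v → CrossingQuadruple j i u v
  CrossingQuadruple-flipˡ {i} {j} (same , il) =
    subst (λ e → page e ≡ _) (edge-comm i j) same , Interleave-flipˡ _ _ _ _ il

  CrossingQuadruple-flipʳ : ∀ {i j u v} → CrossingQuadruple i j u v → CrossingQuadruple i j v u
  CrossingQuadruple-flipʳ {u = u} {v} (same , il) =
    subst (λ e → _ ≡ page e) (edge-comm u v) same , Interleave-flipʳ _ _ _ _ il

  CrossingQuadruple-sorted : ∀ {i j u v} → toℕ i < toℕ j → toℕ u < toℕ v →
    𝟙 (crossingQuadruple? i j u v) ≡ 𝟙 (crosses? ((i , j) , (u , v)))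
  CrossingQuadruple-sorted {i} {j} {u} {v} i<j u<v = 𝟙-cong
    (λ (same , il) → subst₂ (λ e f → page e ≡ page f) (edge-sorted i<j) (edge-sorted u<v) same , il)
    (λ (same , il) → subst₂ (λ e f → page e ≡ page f) (sym (edge-sorted i<j)) (sym (edge-sorted u<v)) same , il)
    (crossingQuadruple? i j u v) (crosses? ((i , j) , (u , v)))

  -- A crossing is counted once for each of the 2 orders of its edges and the 2 × 2 orientations of them.
  ∑⁴-crossingQuadruple : ∑⁴ (λ i j u v → 𝟙 (crossingQuadruple? i j u v)) ≡ 8 * crossings D
  ∑⁴-crossingQuadruple = begin
    (sum λ i → sum λ j → g i j)
      ≡⟨ ∑²-symmetric g g-comm g-diag ⟩
    2 * (sum λ i → sum λ j → 𝟙 (i FinP.<? j) * g i j)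
      ≡⟨ cong (2 *_) (sum-cong-≗ λ i → sum-cong-≗ (sortedTerm i)) ⟩
    2 * (sum λ i → sum λ j → 2 * (𝟙 (i FinP.<? j) * H i j))
      ≡⟨ cong (2 *_) (sum-cong-≗ λ i → *-distribˡ-sum 2 (W i)) ⟨
    2 * (sum λ i → 2 * sum (W i))
      ≡⟨ cong (2 *_) (*-distribˡ-sum 2 (sum ∘ W)) ⟨
    2 * (2 * (sum λ i → sum (W i)))
      ≡⟨ cong (λ x → 2 * (2 * x)) 2*crossings≡∑sorted ⟨
    2 * (2 * (2 * crossings D))
      ≡⟨ cong (2 *_) (*-assoc 2 2 (crossings D)) ⟨
    2 * (4 * crossings D)
      ≡⟨ *-assoc 2 4 (crossings D) ⟨
    8 * crossings D ∎
    where
      open ≡-Reasoning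
      w : Fin n → Fin n → Fin n → Fin n → ℕ
      w i j u v = 𝟙 (crossingQuadruple? i j u v)
      g : Fin n → Fin n → ℕ
      g i j = sum λ u → sum λ v → w i j u v
      H : Fin n → Fin n → ℕ
      H i j = sum λ u → sum λ v → 𝟙 (u FinP.<? v) * 𝟙 (crosses? ((i , j) , (u , v)))
      W : Fin n → Fin n → ℕ
      W i j = 𝟙 (i FinP.<? j) * H i j

      g-comm : ∀ i j → g i j ≡ g j i
      g-comm i j = sum-cong-≗ λ u → sum-cong-≗ λ v →
        𝟙-cong CrossingQuadruple-flipˡ CrossingQuadruple-flipˡ (crossingQuadruple? i j u v) (crossingQuadruple? j i u v)
      g-diag : ∀ i → g i i ≡ 0
      g-diag i = ∑-zero λ u → ∑-zero λ v →
        𝟙-no (λ (_ , il) → Interleave-irreflˡ _ _ _ il) (crossingQuadruple? i i u v)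
      g≡2*∑sorted : ∀ i j → g i j ≡ 2 * (sum λ u → sum λ v → 𝟙 (u FinP.<? v) * w i j u v)
      g≡2*∑sorted i j = ∑²-symmetric (w i j)
        (λ u v → 𝟙-cong CrossingQuadruple-flipʳ CrossingQuadruple-flipʳ
          (crossingQuadruple? i j u v) (crossingQuadruple? i j v u))
        (λ u → 𝟙-no (λ (_ , il) → Interleave-irreflˡ _ _ _ (Interleave-swap _ _ _ _ il)) (crossingQuadruple? i j u u))
      sortedTerm : ∀ i j → 𝟙 (i FinP.<? j) * g i j ≡ 2 * W i j
      sortedTerm i j = trans
        (𝟙-*-cong (λ i<j → trans (g≡2*∑sorted i j) (cong (2 *_) (sum-cong-≗ λ u → sum-cong-≗ λ v →
          𝟙-*-cong (CrossingQuadruple-sorted i<j) (u FinP.<? v)))) (i FinP.<? j))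
        (x*[y*z]≡y*[x*z] (𝟙 (i FinP.<? j)) 2 (H i j))

spineDrawing : ∀ {k n} → (KEdge n → Fin k) → Drawing k n
spineDrawing c = record { pos = idPerm ; page = c }

relabelledPages : ∀ {k n} → Drawing k n → KEdge n → Fin k
relabelledPages D (i , j) = page (edge (pos ⟨$⟩ˡ i) (pos ⟨$⟩ˡ j))
  where open Drawing D

-- The quadruple count runs over all vertices, so renaming them by their spine positions only permutes its terms.
crossings-relabelledPages : ∀ {k n} (D : Drawing k n) → crossings (spineDrawing (relabelledPages D)) ≡ crossings D
crossings-relabelledPages {n = n} D = *-cancelˡ-≡ _ _ 8 (begin
  8 * crossings D′
    ≡⟨ ∑⁴-crossingQuadruple D′ ⟨
  ∑⁴ (λ i j u v → 𝟙 (crossingQuadruple? D′ i j u v))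
    ≡⟨ ∑⁴-permute pos _ ⟩
  ∑⁴ (λ i j u v → 𝟙 (crossingQuadruple? D′ (σ i) (σ j) (σ u) (σ v)))
    ≡⟨ ∑⁴-cong (λ i j u v → 𝟙-cong (samePage i j u v) (samePage′ i j u v) _ _) ⟩
  ∑⁴ (λ i j u v → 𝟙 (crossingQuadruple? D i j u v))
    ≡⟨ ∑⁴-crossingQuadruple D ⟩
  8 * crossings D ∎)
  where
    open ≡-Reasoning
    open Drawing D
    D′ = spineDrawing (relabelledPages D)
    σ : Fin n → Fin n
    σ i = pos ⟨$⟩ʳ i
    page-edge : ∀ i j → relabelledPages D (edge (σ i) (σ j)) ≡ page (edge i j)
    page-edge i j = cong page (trans (edge-map (pos ⟨$⟩ˡ_) (σ i) (σ j)) (cong₂ edge (inverseˡ pos) (inverseˡ pos)))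
    samePage : ∀ i j u v → CrossingQuadruple D′ (σ i) (σ j) (σ u) (σ v) → CrossingQuadruple D i j u v
    samePage i j u v (same , il) = trans (sym (page-edge i j)) (trans same (page-edge u v)) , il
    samePage′ : ∀ i j u v → CrossingQuadruple D i j u v → CrossingQuadruple D′ (σ i) (σ j) (σ u) (σ v)
    samePage′ i j u v (same , il) = trans (page-edge i j) (trans same (sym (page-edge u v))) , il

module _ {k n : ℕ} (c : KEdge n → Fin k) where

  sameColour? : (ef : KEdge n × KEdge n) → Dec (c (proj₁ ef) ≡ c (proj₂ ef))
  sameColour? (e , f) = c e FinP.≟ c f

  monochromatic : ℕ
  monochromatic = length (filter sameColour? (En n))

  length-En≡monochromatic+cutSize : length (En n) ≡ monochromatic + cutSize c
  length-En≡monochromatic+cutSize = sym (length-filter+length-filter-¬ sameColour? (En n))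

  MonochromaticOverlap : KEdge n → KEdge n → Set
  MonochromaticOverlap e f =
    Interleave (toℕ (proj₁ e)) (toℕ (proj₂ e)) (toℕ (proj₁ f)) (toℕ (proj₂ f)) × c e ≡ c f

  monochromaticOverlap? : ∀ e f → Dec (MonochromaticOverlap e f)
  monochromaticOverlap? e f = overlap? (e , f) ×-dec sameColour? (e , f)

  2*monochromatic≡∑⁴ : 2 * monochromatic ≡
    ∑⁴ (λ i j u v → 𝟙 (isChord? n (i , j)) *
      (𝟙 (isChord? n (u , v)) * 𝟙 (monochromaticOverlap? (i , j) (u , v))))
  2*monochromatic≡∑⁴ = begin
    2 * monochromatic
      ≡⟨ cong (2 *_) (length-filter-filter overlap? sameColour? (pairs (Vn n))) ⟩
    2 * ∑ₗ (pairs (Vn n)) (λ (e , f) → m e f)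
      ≡⟨ ∑ₗ-pairs (Vn n) (λ (e , f) → m e f) symmetric irreflexive ⟩
    ∑ₗ (Vn n) (λ e → ∑ₗ (Vn n) (m e))
      ≡⟨ ∑ₗ-cong (Vn n) (λ e → ∑ₗ-filter-allFin² n (isChord? n) (m e)) ⟩
    ∑ₗ (Vn n) (λ e → sum λ u → sum λ v → 𝟙 (isChord? n (u , v)) * m e (u , v))
      ≡⟨ ∑ₗ-filter-allFin² n (isChord? n) (λ e → sum λ u → sum λ v → 𝟙 (isChord? n (u , v)) * m e (u , v))
       ⟩
    (sum λ i → sum λ j → 𝟙 (isChord? n (i , j)) *
      sum λ u → sum λ v → 𝟙 (isChord? n (u , v)) * m (i , j) (u , v))
      ≡⟨ ∑²-*-∑² (λ i j → 𝟙 (isChord? n (i , j))) (λ i j u v → 𝟙 (isChord? n (u , v)) * m (i , j) (u , v))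
       ⟩
    ∑⁴ (λ i j u v → 𝟙 (isChord? n (i , j)) * (𝟙 (isChord? n (u , v)) * m (i , j) (u , v))) ∎
    where
      open ≡-Reasoning
      m : KEdge n → KEdge n → ℕ
      m e f = 𝟙 (monochromaticOverlap? e f)
      swap : ∀ e f → MonochromaticOverlap e f → MonochromaticOverlap f e
      swap e f (il , same) = Interleave-swap _ _ _ _ il , sym same
      symmetric : ∀ e f → m e f ≡ m f e
      symmetric e f = 𝟙-cong (swap e f) (swap f e) (monochromaticOverlap? e f) (monochromaticOverlap? f e)
      irreflexive : ∀ e → m e e ≡ 0
      irreflexive e = 𝟙-no (λ (il , _) → Interleave-irrefl _ _ il) (monochromaticOverlap? e e)

  -- On the spine 0, 1, …, n-1 two edges interleave iff both are chords of the cycle and overlap.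
  crossings-spineDrawing≡monochromatic : crossings (spineDrawing c) ≡ monochromatic
  crossings-spineDrawing≡monochromatic = *-cancelˡ-≡ _ _ 2 (begin
    2 * crossings D
      ≡⟨ 2*crossings≡∑sorted D ⟩
    (sum λ i → sum λ j → 𝟙 (i FinP.<? j) * sum λ u → sum λ v → 𝟙 (u FinP.<? v) * crossing (i , j) (u , v))
      ≡⟨ ∑²-*-∑² (λ i j → 𝟙 (i FinP.<? j)) (λ i j u v → 𝟙 (u FinP.<? v) * crossing (i , j) (u , v)) ⟩
    ∑⁴ (λ i j u v → 𝟙 (i FinP.<? j) * (𝟙 (u FinP.<? v) * crossing (i , j) (u , v)))
      ≡⟨ ∑⁴-cong (λ i j u v → 𝟙³-cong (crossing⇒overlap i j u v) overlap⇒crossing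
           (i FinP.<? j) (u FinP.<? v) (crosses? D ((i , j) , (u , v)))
           (isChord? n (i , j)) (isChord? n (u , v)) (monochromaticOverlap? (i , j) (u , v))) ⟩
    ∑⁴ (λ i j u v → 𝟙 (isChord? n (i , j)) *
      (𝟙 (isChord? n (u , v)) * 𝟙 (monochromaticOverlap? (i , j) (u , v))))
      ≡⟨ 2*monochromatic≡∑⁴ ⟨
    2 * monochromatic ∎)
    where
      open ≡-Reasoning
      D = spineDrawing c
      crossing : KEdge n → KEdge n → ℕ
      crossing e f = 𝟙 (crosses? D (e , f))
      crossing⇒overlap : ∀ i j u v → toℕ i < toℕ j × toℕ u < toℕ v × Crosses D ((i , j) , (u , v)) →
        IsChord n (i , j) × IsChord n (u , v) × MonochromaticOverlap (i , j) (u , v)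
      crossing⇒overlap i j u v (i<j , u<v , same , il) =
        interleave⇒chord i j u v i<j u<v il ,
        interleave⇒chord u v i j u<v i<j (Interleave-swap _ _ _ _ il) ,
        il , same
      overlap⇒crossing : ∀ {i j u v} →
        IsChord n (i , j) × IsChord n (u , v) × MonochromaticOverlap (i , j) (u , v) →
        toℕ i < toℕ j × toℕ u < toℕ v × Crosses D ((i , j) , (u , v))
      overlap⇒crossing ((i<j , _) , (u<v , _) , il , same) = i<j , u<v , same , il

  crossings-spineDrawing : crossings (spineDrawing c) ≡ length (En n) ∸ cutSize c
  crossings-spineDrawing = begin
    crossings (spineDrawing c)               ≡⟨ crossings-spineDrawing≡monochromatic ⟩
    monochromatic                            ≡⟨ m+n∸n≡m monochromatic (cutSize c) ⟨
    monochromatic + cutSize c ∸ cutSize c    ≡⟨ cong (_∸ cutSize c) length-En≡monochromatic+cutSize ⟨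
    length (En n) ∸ cutSize c                ∎
    where open ≡-Reasoning

-- Maximising over functions between finite types

module _ {A B : Set} (_≟_ : DecidableEquality A) (b₀ : B) (bs : List B) where

  _[_≔_] : (A → B) → A → B → A → B
  (f [ a ≔ b ]) x with x ≟ a
  ... | yes _ = b
  ... | no _  = f x

  functionsOn : List A → List (A → B)
  functionsOn []       = (λ _ → b₀) ∷ []
  functionsOn (a ∷ as) = concatMap (λ f → map (f [ a ≔_]) bs) (functionsOn as)

  functionsOn-complete : (∀ b → b ∈ bs) → (g : A → B) → ∀ as →
    Σ (A → B) λ f → f ∈ functionsOn as × (∀ x → x ∈ as → f x ≡ g x)
  functionsOn-complete ∈bs g []       = (λ _ → b₀) , here refl , λ _ ()
  functionsOn-complete ∈bs g (a ∷ as) with functionsOn-complete ∈bs g as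
  ... | f , f∈ , f≗g = f [ a ≔ g a ] ,
    ∈-concatMap⁺ (λ f → map (f [ a ≔_]) bs) (Any.map (λ { refl → ∈-map⁺ (f [ a ≔_]) (∈bs (g a)) }) f∈) ,
    agrees
    where
      agrees : ∀ x → x ∈ a ∷ as → (f [ a ≔ g a ]) x ≡ g x
      agrees x x∈ with x ≟ a
      agrees x x∈         | yes x≡a = cong g (sym x≡a)
      agrees x (here x≡a) | no x≢a  = ⊥-elim (x≢a x≡a)
      agrees x (there x∈) | no _    = f≗g x x∈

  maximiser : (score : (A → B) → ℕ) → (∀ {f g} → (∀ x → f x ≡ g x) → score f ≡ score g) →
    (as : List A) → (∀ a → a ∈ as) → (∀ b → b ∈ bs) →
    Σ (A → B) λ f → ∀ g → score g ≤ score f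
  maximiser score score-cong as ∈as ∈bs = best , maximal
    where
      best = argmax score (λ _ → b₀) (functionsOn as)
      maximal : ∀ g → score g ≤ score best
      maximal g with functionsOn-complete ∈bs g as
      ... | f , f∈ , f≗g = subst (_≤ score best) (score-cong (λ x → f≗g x (∈as x)))
        (All.lookup (f[xs]≤f[argmax] (λ _ → b₀) (functionsOn as)) f∈)

cutSize-cong : ∀ {k n} {col col′ : KEdge n → Fin k} → (∀ e → col e ≡ col′ e) → cutSize col ≡ cutSize col′
cutSize-cong {n = n} {col} {col′} col≗col′ = begin
  cutSize col
    ≡⟨ length-filter (¬? ∘ sameColour? col) (En n) ⟩
  ∑ₗ (En n) (𝟙 ∘ ¬? ∘ sameColour? col)
    ≡⟨ ∑ₗ-cong (En n) (λ e → 𝟙-cong (λ ≢ ≡ → ≢ (recolour′ ≡)) (λ ≢ ≡ → ≢ (recolour ≡))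
         (¬? (sameColour? col e)) (¬? (sameColour? col′ e))) ⟩
  ∑ₗ (En n) (𝟙 ∘ ¬? ∘ sameColour? col′)
    ≡⟨ length-filter (¬? ∘ sameColour? col′) (En n) ⟨
  cutSize col′ ∎
  where
    open ≡-Reasoning
    recolour : ∀ {e f} → col e ≡ col f → col′ e ≡ col′ f
    recolour {e} {f} same = trans (sym (col≗col′ e)) (trans same (col≗col′ f))
    recolour′ : ∀ {e f} → col′ e ≡ col′ f → col e ≡ col f
    recolour′ {e} {f} same = trans (col≗col′ e) (trans same (sym (col≗col′ f)))

maxCut : ∀ n k → Σ (KEdge n → Fin (suc k)) λ col → ∀ col′ → cutSize col′ ≤ cutSize col
maxCut n k = maximiser (≡-dec FinP._≟_ FinP._≟_) fzero (allFin (suc k)) cutSize cutSize-cong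
  (cartesianProduct (allFin n) (allFin n)) (λ (i , j) → ∈-cartesianProduct⁺ (∈-allFin i) (∈-allFin j)) ∈-allFin

-- The identity holds for every n.
lemma1 : (n k : ℕ) → 3 ≤ n → 1 ≤ k →
    Σ (Drawing k n) λ D → Σ (Fin n × Fin n → Fin k) λ col →
      ((D′ : Drawing k n) → crossings D ≤ crossings D′) ×
      ((col′ : Fin n × Fin n → Fin k) → cutSize col′ ≤ cutSize col) ×
      crossings D ≡ length (En n) ∸ cutSize col
lemma1 n zero    _ ()
lemma1 n (suc k) _ _ with maxCut n k
... | col , maximal = spineDrawing col , col , minimal , maximal , crossings-spineDrawing col
  where
    minimal : (D′ : Drawing (suc k) n) → crossings (spineDrawing col) ≤ crossings D′
    minimal D′ = begin
      crossings (spineDrawing col)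
        ≡⟨ crossings-spineDrawing col ⟩
      length (En n) ∸ cutSize col
        ≤⟨ ∸-monoʳ-≤ (length (En n)) (maximal (relabelledPages D′)) ⟩
      length (En n) ∸ cutSize (relabelledPages D′)
        ≡⟨ crossings-spineDrawing (relabelledPages D′) ⟨
      crossings (spineDrawing (relabelledPages D′))
        ≡⟨ crossings-relabelledPages D′ ⟩
      crossings D′ ∎
      where open ≤-Reasoning
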